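{- Let $k\in\mathbb{N}$ and let $G=(V,E)$ be an undirected graph with exactly $k'$ vertices, where $k<k'\le\frac{3}{2}k$. Let $b=\frac{k'-k}{k'}$. Then the optimum value of $k$-Edge Separator on $(G,k)$ equals the optimum value of Balanced $b$-Cut on $G$.
   Context: $k$-Edge Separator: find $S\subseteq E$ of minimum size such that every connected component of $(V,E\setminus S)$ has at most $k$ vertices. Balanced $b$-Cut (for $b\in(0,1/2]$) on a graph with $n$ vertices: find $S\subseteq V$ with $bn\le|S|\le(1-b)n$ minimizing the number of edges with exactly one endpoint in $S$. -}

module Defs where

open import Data.Nat using (ℕ; zero; suc; _+_; _*_; _∸_; _≤_; _<_)
open import Data.Bool using (Bool; true; false; _∧_; _∨_; not; if_then_else_; _xor_)
open import Data.Fin using (Fin; toℕ)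
open import Data.Fin.Subset using (Subset; ∣_∣)
open import Data.Vec using (lookup)
open import Data.List using (List; length; allFin; map)
open import Data.Nat.ListAction using (sum)
open import Data.List.Relation.Unary.All using (All)
open import Data.List.Relation.Unary.Unique.Propositional using (Unique)
open import Data.Product using (Σ; _×_; ∃-syntax; _,_; proj₁)
open import Relation.Binary.PropositionalEquality using (_≡_)
open import Relation.Nullary.Decidable using (⌊_⌋)
import Data.Nat as ℕ

record Graph (n : ℕ) : Set where
  field
    adj    : Fin n → Fin n → Bool
    adj-sym : ∀ u v → adj u v ≡ adj v u
    adj-irrefl : ∀ u → adj u u ≡ false
open Graph public

-- Number of unordered pairs {u,v} (u < v) satisfying a Boolean relation
-- (each such pair is looked up in the orientation u < v).
pairCount : ∀ {n} → (Fin n → Fin n → Bool) → ℕ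
pairCount {n} R =
  sum (map (λ u → sum (map (λ v → if ⌊ toℕ u ℕ.<? toℕ v ⌋ ∧ R u v then 1 else 0)
                           (allFin n)))
           (allFin n))

-- Edge sets E(G) as sets of pairs (u,v) with u < v.
-- A subset S ⊆ E is a Boolean relation that is only true on edges (u,v), u < v.
EdgeSubset : ∀ {n} → Graph n → Set
EdgeSubset {n} G =
  Σ (Fin n → Fin n → Bool) λ S → ∀ u v → S u v ≡ true → (toℕ u < toℕ v) × (adj G u v ≡ true)

edgeSubsetSize : ∀ {n} (G : Graph n) → EdgeSubset G → ℕ
edgeSubsetSize G S = pairCount (proj₁ S)

removeEdges : ∀ {n} (G : Graph n) → EdgeSubset G → Fin n → Fin n → Bool
removeEdges G S u v = adj G u v ∧ not (proj₁ S u v ∨ proj₁ S v u)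

data Reach {n} (R : Fin n → Fin n → Bool) : Fin n → Fin n → Set where
  here : ∀ {u} → Reach R u u
  step : ∀ {u w v} → R u w ≡ true → Reach R w v → Reach R u v

-- every connected component has at most k vertices:
-- the component of v is {w | Reach R v w}; its cardinality is ≤ k,
-- i.e. every duplicate-free list of its members has length ≤ k.
ComponentsAtMost : ∀ {n} → (Fin n → Fin n → Bool) → ℕ → Set
ComponentsAtMost {n} R k =
  ∀ (v : Fin n) (xs : List (Fin n)) → Unique xs → All (Reach R v) xs → length xs ≤ k

IsKEdgeSeparator : ∀ {n} (G : Graph n) → ℕ → EdgeSubset G → Set
IsKEdgeSeparator G k S = ComponentsAtMost (removeEdges G S) k

KEdgeSepOpt : ∀ {n} (G : Graph n) (k : ℕ) (m : ℕ) → Set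
KEdgeSepOpt G k m =
  (Σ (EdgeSubset G) λ S → IsKEdgeSeparator G k S × edgeSubsetSize G S ≡ m) ×
  (∀ (S : EdgeSubset G) → IsKEdgeSeparator G k S → m ≤ edgeSubsetSize G S)

cutSize : ∀ {n} (G : Graph n) → Subset n → ℕ
cutSize G S = pairCount (λ u v → adj G u v ∧ (lookup S u xor lookup S v))

-- Balanced b-Cut with b = p / q (q > 0), on a graph with n vertices:
-- feasible S satisfy b·n ≤ |S| ≤ (1 − b)·n, i.e. p·n ≤ q·|S| ≤ (q − p)·n.
IsBalanced : ∀ {n} (p q : ℕ) → Subset n → Set
IsBalanced {n} p q S = (p * n ≤ q * ∣ S ∣) × (q * ∣ S ∣ ≤ (q ∸ p) * n)

BalancedCutOpt : ∀ {n} (G : Graph n) (p q : ℕ) (m : ℕ) → Set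
BalancedCutOpt {n} G p q m =
  (Σ (Subset n) λ S → IsBalanced p q S × cutSize G S ≡ m) ×
  (∀ (S : Subset n) → IsBalanced p q S → m ≤ cutSize G S)

-- Let L = k' − k, so that the balanced sets are exactly those with L ≤ |S| ≤ k, and the hypothesis
-- k' ≤ 3k/2 reads 2L ≤ k.  The edges cut by a balanced S form a k-edge separator: every component
-- of what remains lies inside S or inside its complement, and both have at most k vertices.
-- Conversely, given a k-edge separator T, add whole components of (V, E \ T) to a set S until
-- |S| ≥ L: a component of size ≥ L can be taken on its own, and otherwise the union stays below
-- 2L ≤ k.  Such an S is a union of components, so every edge it cuts lies in T.
module Submission where

open import Defs
open import Data.Nat using (ℕ; zero; suc; _+_; _*_; _∸_; _≤_; _<_; _≤?_; _<?_; z≤n; s≤s; NonZero)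
open import Data.Nat.Base using (>-nonZero)
open import Data.Nat.Properties
  using (≤-refl; ≤-reflexive; ≤-trans; <⇒≤; <-≤-trans; ≰⇒>; <⇒≱; <⇒≯; <-cmp; +-suc; +-identityʳ; *-comm;
         +-mono-≤; +-monoˡ-≤; +-monoʳ-≤; +-cancelʳ-≤; *-monoʳ-≤; *-cancelˡ-≤; ∸-monoʳ-≤; m≤n+m;
         m+n≤o⇒m≤o; m∸n≤m; m+[n∸m]≡n; m∸[m∸n]≡n; m<n⇒0<n; m<n⇒0<n∸m; module ≤-Reasoning)
open import Data.Nat.ListAction using (sum)
open import Data.Nat.Tactic.RingSolver using (solve-∀)
open import Data.Bool using (Bool; true; false; _∧_; _∨_; not; if_then_else_; _xor_)
open import Data.Bool.Properties using (∧-assoc; ∧-idem; ∧-identityʳ; ∨-zeroʳ; ∨-comm; xor-comm; xor-same)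
open import Data.Fin using (Fin; zero; suc; toℕ)
open import Data.Fin.Properties using (toℕ-injective; suc-injective; ∀-cons; ¬∀⟶∃¬)
open import Data.Fin.Subset using (Subset; ∣_∣; _∈_; _∉_; _⊆_; _⊂_; _∪_; ∁; ⊥; ⊤; ⁅_⁆; ⋃; inside; outside)
open import Data.Fin.Subset.Properties
  using (_∈?_; anySubset?; ∣⊥∣≡0; ∣⊤∣≡n; ∣p∣≤∣x∷p∣; ∣∁p∣≡n∸∣p∣; p⊆q⇒∣p∣≤∣q∣; p⊂q⇒∣p∣<∣q∣;
         p⊆p∪q; q⊆p∪q; x∈p∪q⁺; x∈p∪q⁻; x∈⁅x⁆; x∈⁅y⁆⇒x≡y; ∉⊥)
open import Data.Vec using ([]; _∷_; lookup; tabulate; here; there)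
open import Data.Vec.Properties
  using (lookup∘tabulate; lookup⇒[]=; []=⇒lookup; lookup-map; lookup-zipWith; lookup-replicate)
open import Data.List using (List; []; _∷_; length; map; allFin)
open import Data.List.Properties using (length-map; map-cong)
open import Data.List.Relation.Unary.All as All using (All; []; _∷_)
import Data.List.Relation.Unary.All.Properties as All
open import Data.List.Relation.Unary.Any using (here; there)
import Data.List.Membership.Propositional as List
open import Data.List.Relation.Unary.AllPairs using ([]; _∷_)
open import Data.List.Relation.Unary.Unique.Propositional using (Unique)
import Data.List.Relation.Unary.Unique.Propositional.Properties as Unique
open import Data.Product using (Σ-syntax; _×_; ∃-syntax; _,_; proj₁; proj₂)
open import Data.Sum using (inj₁; inj₂)
open import Function using (_∘_; _⇔_; mk⇔; Equivalence)
open import Relation.Nullary using (¬_; Dec; yes; no; does; contradiction)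
open import Relation.Nullary.Decidable using (⌊_⌋; decidable-stable; dec-true; _×-dec_; ¬¬-excluded-middle; does-⇔)
open import Relation.Nullary.Negation using (¬¬-map)
open import Relation.Unary using (Decidable)
open import Relation.Binary.PropositionalEquality
open import Relation.Binary.Definitions using (tri<; tri≈; tri>)

private
  variable
    n k : ℕ

∣p∪q∣≤∣p∣+∣q∣ : (p q : Subset n) → ∣ p ∪ q ∣ ≤ ∣ p ∣ + ∣ q ∣
∣p∪q∣≤∣p∣+∣q∣ []            []            = z≤n
∣p∪q∣≤∣p∣+∣q∣ (inside  ∷ p) (s       ∷ q) = s≤s (≤-trans (∣p∪q∣≤∣p∣+∣q∣ p q) (+-monoʳ-≤ ∣ p ∣ (∣p∣≤∣x∷p∣ s q)))
∣p∪q∣≤∣p∣+∣q∣ (outside ∷ p) (inside  ∷ q) = subst (suc ∣ p ∪ q ∣ ≤_) (sym (+-suc ∣ p ∣ ∣ q ∣)) (s≤s (∣p∪q∣≤∣p∣+∣q∣ p q))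
∣p∪q∣≤∣p∣+∣q∣ (outside ∷ p) (outside ∷ q) = ∣p∪q∣≤∣p∣+∣q∣ p q

subsetOfSize : ∀ m → m ≤ n → Σ[ p ∈ Subset n ] ∣ p ∣ ≡ m
subsetOfSize {n}     zero    _         = ⊥ {n} , ∣⊥∣≡0 n
subsetOfSize {suc n} (suc m) (s≤s m≤n) with subsetOfSize m m≤n
... | p , ∣p∣≡m = inside ∷ p , cong suc ∣p∣≡m

members : Subset n → List (Fin n)
members []            = []
members (inside  ∷ p) = zero ∷ map suc (members p)
members (outside ∷ p) = map suc (members p)

length-members : (p : Subset n) → length (members p) ≡ ∣ p ∣
length-members []            = refl
length-members (inside  ∷ p) = cong suc (trans (length-map suc (members p)) (length-members p))
length-members (outside ∷ p) = trans (length-map suc (members p)) (length-members p)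

members-unique : (p : Subset n) → Unique (members p)
members-unique []            = []
members-unique (inside  ∷ p) = All.map⁺ (All.tabulate (λ _ ())) ∷ Unique.map⁺ suc-injective (members-unique p)
members-unique (outside ∷ p) = Unique.map⁺ suc-injective (members-unique p)

members-⊆ : (p : Subset n) → All (_∈ p) (members p)
members-⊆ []            = []
members-⊆ (inside  ∷ p) = here ∷ All.map⁺ (All.map there (members-⊆ p))
members-⊆ (outside ∷ p) = All.map⁺ (All.map there (members-⊆ p))

module _ {n : ℕ} where

  private
    fromList : List (Fin n) → Subset n
    fromList xs = ⋃ (map ⁅_⁆ xs)

    ∈-fromList⁻ : ∀ {x} xs → x ∈ fromList xs → x List.∈ xs
    ∈-fromList⁻ []       x∈ = contradiction x∈ ∉⊥
    ∈-fromList⁻ (y ∷ xs) x∈ with x∈p∪q⁻ ⁅ y ⁆ (fromList xs) x∈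
    ... | inj₁ x∈⁅y⁆ = here (x∈⁅y⁆⇒x≡y y x∈⁅y⁆)
    ... | inj₂ x∈xs  = there (∈-fromList⁻ xs x∈xs)

    length≤∣fromList∣ : ∀ {xs} → Unique xs → length xs ≤ ∣ fromList xs ∣
    length≤∣fromList∣ []                     = z≤n
    length≤∣fromList∣ {x ∷ xs} (x∉xs ∷ uxs) =
      ≤-trans (s≤s (length≤∣fromList∣ uxs)) (p⊂q⇒∣p∣<∣q∣ fromList-xs⊂)
      where
      fromList-xs⊂ : fromList xs ⊂ fromList (x ∷ xs)
      fromList-xs⊂ = q⊆p∪q ⁅ x ⁆ (fromList xs) , x , x∈p∪q⁺ (inj₁ (x∈⁅x⁆ x)) ,
                      λ x∈ → All.lookup x∉xs (∈-fromList⁻ xs x∈) refl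

    fromList-⊆ : ∀ {p xs} → All (_∈ p) xs → fromList xs ⊆ p
    fromList-⊆ []           x∈ = contradiction x∈ ∉⊥
    fromList-⊆ {xs = y ∷ _} (y∈p ∷ xs⊆p) x∈ with x∈p∪q⁻ ⁅ y ⁆ _ x∈
    ... | inj₁ x∈⁅y⁆ = subst (_∈ _) (sym (x∈⁅y⁆⇒x≡y y x∈⁅y⁆)) y∈p
    ... | inj₂ x∈xs  = fromList-⊆ xs⊆p x∈xs

  unique⇒length≤∣p∣ : ∀ {p xs} → Unique xs → All (_∈ p) xs → length xs ≤ ∣ p ∣
  unique⇒length≤∣p∣ uxs xs⊆p = ≤-trans (length≤∣fromList∣ uxs) (p⊆q⇒∣p∣≤∣q∣ (fromList-⊆ xs⊆p))

-- The least value is found by descending from a known value, using that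
-- "some P-subset has f-value ≤ m" is decidable by exhaustive search.
subset-argmin : {P : Subset n → Set} → Decidable P → (f : Subset n → ℕ) →
                ∃[ p ] P p → ∃[ p ] P p × (∀ q → P q → f p ≤ f q)
subset-argmin {P = P} P? f (p , Pp) = descend (f p) (p , Pp , ≤-refl)
  where
  descend : ∀ m → ∃[ p ] P p × f p ≤ m → ∃[ p ] P p × (∀ q → P q → f p ≤ f q)
  descend zero    (p , Pp , fp≤0) = p , Pp , λ _ _ → ≤-trans fp≤0 z≤n
  descend (suc m) (p , Pp , fp≤1+m) with anySubset? (λ q → P? q ×-dec f q ≤? m)
  ... | yes below = descend m below
  ... | no ¬below = p , Pp , λ q Pq → ≤-trans fp≤1+m (≰⇒> (λ fq≤m → ¬below (q , Pq , fq≤m)))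

¬¬-∀ : {P : Fin n → Set} → (∀ i → ¬ ¬ P i) → ¬ ¬ (∀ i → P i)
¬¬-∀ {zero}  ¬¬P ¬∀P = ¬∀P (λ ())
¬¬-∀ {suc n} ¬¬P ¬∀P = ¬¬P zero (λ P₀ → ¬¬-∀ (¬¬P ∘ suc) (¬∀P ∘ ∀-cons P₀))

-- Reachability and unions of components

module _ (R : Fin n → Fin n → Bool) where

  reach-snoc : ∀ {u v w} → Reach R u v → R v w ≡ true → Reach R u w
  reach-snoc here         e = step e here
  reach-snoc (step e′ r)  e = step e′ (reach-snoc r e)

  Closed : Subset n → Set
  Closed S = ∀ {a b} → R a b ≡ true → lookup S a ≡ lookup S b

  closed-reach : ∀ S {u v} → Closed S → Reach R u v → lookup S u ≡ lookup S v
  closed-reach S cS here       = refl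
  closed-reach S cS (step e r) = trans (cS e) (closed-reach S cS r)

  ∪-closed : ∀ S T → Closed S → Closed T → Closed (S ∪ T)
  ∪-closed S T cS cT {a} {b} e = begin
    lookup (S ∪ T) a          ≡⟨ lookup-zipWith _∨_ a S T ⟩
    lookup S a ∨ lookup T a   ≡⟨ cong₂ _∨_ (cS e) (cT e) ⟩
    lookup S b ∨ lookup T b   ≡⟨ lookup-zipWith _∨_ b S T ⟨
    lookup (S ∪ T) b          ∎
    where open ≡-Reasoning

  closed⇒componentsAtMost : ∀ S → Closed S → ∣ S ∣ ≤ k → ∣ ∁ S ∣ ≤ k → ComponentsAtMost R k
  closed⇒componentsAtMost S cS ∣S∣≤k ∣∁S∣≤k v xs uxs reach with lookup S v in Sv
  ... | true  = ≤-trans (unique⇒length≤∣p∣ uxs (All.map (λ r → lookup⇒[]= _ S (sideOf r))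
                                                        reach)) ∣S∣≤k
    where sideOf : ∀ {x} → Reach R v x → lookup S x ≡ true
          sideOf r = trans (sym (closed-reach S cS r)) Sv
  ... | false = ≤-trans (unique⇒length≤∣p∣ uxs (All.map (λ r → lookup⇒[]= _ (∁ S) (sideOf r))
                                                        reach)) ∣∁S∣≤k
    where sideOf : ∀ {x} → Reach R v x → lookup (∁ S) x ≡ true
          sideOf {x} r = trans (lookup-map x not S) (cong not (trans (sym (closed-reach S cS r)) Sv))

  module Components (R-sym : ∀ {a b} → R a b ≡ true → R b a ≡ true)
                    (reach? : ∀ u v → Dec (Reach R u v)) where

    component : Fin n → Subset n
    component v = tabulate (does ∘ reach? v)

    ∈-component⁺ : ∀ {v w} → Reach R v w → w ∈ component v
    ∈-component⁺ {v} {w} r = lookup⇒[]= w (component v)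
      (trans (lookup∘tabulate (does ∘ reach? v) w) (dec-true (reach? v w) r))

    ∈-component⁻ : ∀ {v w} → w ∈ component v → Reach R v w
    ∈-component⁻ {v} {w} w∈ with reach? v w | lookup∘tabulate (does ∘ reach? v) w
    ... | yes r | _  = r
    ... | no  _ | eq = contradiction (trans (sym ([]=⇒lookup w∈)) eq) λ ()

    component-closed : ∀ v → Closed (component v)
    component-closed v {a} {b} e = begin
      lookup (component v) a  ≡⟨ lookup∘tabulate (does ∘ reach? v) a ⟩
      does (reach? v a)       ≡⟨ does-⇔ (mk⇔ (λ r → reach-snoc r e) (λ r → reach-snoc r (R-sym e)))
                                        (reach? v a) (reach? v b) ⟩
      does (reach? v b)       ≡⟨ lookup∘tabulate (does ∘ reach? v) b ⟨
      lookup (component v) b  ∎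
      where open ≡-Reasoning

    ∣component∣≤ : ComponentsAtMost R k → ∀ v → ∣ component v ∣ ≤ k
    ∣component∣≤ {k} small v = subst (_≤ k) (length-members (component v))
      (small v (members (component v)) (members-unique (component v))
               (All.map ∈-component⁻ (members-⊆ (component v))))

    module _ (small : ComponentsAtMost R k) {L} (L≤n : L ≤ n) (2L≤k : L + L ≤ k) where

      private
        Result : Set
        Result = ∃[ S ] Closed S × L ≤ ∣ S ∣ × ∣ S ∣ ≤ k

        vertexOutside : ∀ {S} → ∣ S ∣ < L → ∃[ v ] v ∉ S
        vertexOutside {S} ∣S∣<L = ¬∀⟶∃¬ n (_∈ S) (_∈? S) λ ⊤⊆S →
          <⇒≱ (<-≤-trans ∣S∣<L L≤n) (subst (_≤ ∣ S ∣) (∣⊤∣≡n n) (p⊆q⇒∣p∣≤∣q∣ {p = ⊤} (λ {x} _ → ⊤⊆S x)))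

        -- each round adds the vertex v ∉ S, so L rounds suffice
        grow : ∀ fuel S → Closed S → ∣ S ∣ < L → L ≤ ∣ S ∣ + fuel → Result
        grow zero S _ ∣S∣<L L≤∣S∣+0 = contradiction (subst (L ≤_) (+-identityʳ ∣ S ∣) L≤∣S∣+0) (<⇒≱ ∣S∣<L)
        grow (suc fuel) S cS ∣S∣<L bound with vertexOutside ∣S∣<L
        ... | v , v∉S with L ≤? ∣ component v ∣ | L ≤? ∣ S ∪ component v ∣
        ... | yes large | _ = component v , component-closed v , large , ∣component∣≤ small v
        ... | no ¬large | yes large′ =
          S ∪ component v , ∪-closed S (component v) cS (component-closed v) , large′ ,
          ≤-trans (∣p∪q∣≤∣p∣+∣q∣ S (component v)) (≤-trans (+-mono-≤ (<⇒≤ ∣S∣<L) (<⇒≤ (≰⇒> ¬large))) 2L≤k)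
        ... | no _ | no ¬large′ =
          grow fuel (S ∪ component v) (∪-closed S (component v) cS (component-closed v)) (≰⇒> ¬large′)
            (≤-trans bound (≤-trans (≤-reflexive (+-suc ∣ S ∣ fuel)) (+-monoˡ-≤ fuel (p⊂q⇒∣p∣<∣q∣ S⊂S∪C))))
          where
          S⊂S∪C : S ⊂ S ∪ component v
          S⊂S∪C = p⊆p∪q (component v) , v , x∈p∪q⁺ (inj₂ (∈-component⁺ here)) , v∉S

      componentUnion-between : 0 < L → ∃[ S ] Closed S × L ≤ ∣ S ∣ × ∣ S ∣ ≤ k
      componentUnion-between 0<L = grow L ⊥ ⊥-closed (subst (_< L) (sym (∣⊥∣≡0 n)) 0<L) (m≤n+m L ∣ ⊥ {n} ∣)
        where
        ⊥-closed : Closed ⊥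
        ⊥-closed {a} {b} _ = trans (lookup-replicate a false) (sym (lookup-replicate b false))

-- Cuts and edge separators

xor≡false⇒≡ : ∀ {x y} → x xor y ≡ false → x ≡ y
xor≡false⇒≡ {true}  {true}  _ = refl
xor≡false⇒≡ {false} {false} _ = refl

∧-not-true⁻ : ∀ {x y} → x ∧ not y ≡ true → x ≡ true × y ≡ false
∧-not-true⁻ {true} {false} _ = refl , refl

oriented : (Fin n → Fin n → Bool) → Fin n → Fin n → Bool
oriented A u v = ⌊ toℕ u <? toℕ v ⌋ ∧ A u v

oriented⁺ : ∀ A {u v : Fin n} → toℕ u < toℕ v → A u v ≡ true → oriented A u v ≡ true
oriented⁺ A {u} {v} u<v e with toℕ u <? toℕ v
... | yes _    = e
... | no u≮v = contradiction u<v u≮v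

oriented⁻ : ∀ A (u v : Fin n) → oriented A u v ≡ true → toℕ u < toℕ v × A u v ≡ true
oriented⁻ A u v e with toℕ u <? toℕ v
... | yes u<v = u<v , e

module _ {n : ℕ} where

  private
    indicator : Bool → ℕ
    indicator b = if b then 1 else 0

    indicator-mono : ∀ {a b} → (a ≡ true → b ≡ true) → indicator a ≤ indicator b
    indicator-mono {false} _   = z≤n
    indicator-mono {true}  a⇒b rewrite a⇒b refl = ≤-refl

    sum-map-mono : {A : Set} {f g : A → ℕ} → (∀ x → f x ≤ g x) → ∀ xs → sum (map f xs) ≤ sum (map g xs)
    sum-map-mono f≤g []       = z≤n
    sum-map-mono f≤g (x ∷ xs) = +-mono-≤ (f≤g x) (sum-map-mono f≤g xs)

  pairCount-mono : (A B : Fin n → Fin n → Bool) →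
                   (∀ u v → oriented A u v ≡ true → oriented B u v ≡ true) → pairCount A ≤ pairCount B
  pairCount-mono A B A⇒B =
    sum-map-mono (λ u → sum-map-mono (λ v → indicator-mono (A⇒B u v)) (allFin n)) (allFin n)

  pairCount-cong : (A B : Fin n → Fin n → Bool) →
                   (∀ u v → oriented A u v ≡ oriented B u v) → pairCount A ≡ pairCount B
  pairCount-cong A B A≡B =
    cong sum (map-cong (λ u → cong sum (map-cong (λ v → cong indicator (A≡B u v)) (allFin n))) (allFin n))

module _ (G : Graph n) where

  removeEdges-sym : ∀ (T : EdgeSubset G) {a b} → removeEdges G T a b ≡ true → removeEdges G T b a ≡ true
  removeEdges-sym T {a} {b} e =
    trans (cong₂ (λ x y → x ∧ not y) (adj-sym G b a) (∨-comm (proj₁ T b a) (proj₁ T a b))) e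

  crosses : Subset n → Fin n → Fin n → Bool
  crosses S u v = adj G u v ∧ (lookup S u xor lookup S v)

  crosses⁻ : ∀ S u v → crosses S u v ≡ true → adj G u v ≡ true × lookup S u xor lookup S v ≡ true
  crosses⁻ S u v e with adj G u v
  ... | true = refl , e

  crosses-sym : ∀ S {a b} → crosses S a b ≡ true → crosses S b a ≡ true
  crosses-sym S {a} {b} e = trans (cong₂ _∧_ (adj-sym G b a) (xor-comm (lookup S b) (lookup S a))) e

  cutEdges : Subset n → EdgeSubset G
  cutEdges S = oriented (crosses S) , λ u v e →
    let (u<v , uv-crosses) = oriented⁻ (crosses S) u v e in u<v , proj₁ (crosses⁻ S u v uv-crosses)

  edgeSubsetSize-cutEdges : ∀ S → edgeSubsetSize G (cutEdges S) ≡ cutSize G S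
  edgeSubsetSize-cutEdges S = pairCount-cong (oriented (crosses S)) (crosses S)
    (λ u v → let u<?v = ⌊ toℕ u <? toℕ v ⌋ in
      trans (sym (∧-assoc u<?v u<?v (crosses S u v))) (cong (_∧ crosses S u v) (∧-idem u<?v)))

  crosses⇒oriented : ∀ S {a b} → crosses S a b ≡ true →
                     oriented (crosses S) a b ∨ oriented (crosses S) b a ≡ true
  crosses⇒oriented S {a} {b} e with <-cmp (toℕ a) (toℕ b)
  ... | tri< a<b _ _ = cong (_∨ oriented (crosses S) b a) (oriented⁺ (crosses S) a<b e)
  ... | tri> _ _ b<a =
    trans (cong (oriented (crosses S) a b ∨_) (oriented⁺ (crosses S) b<a (crosses-sym S e))) (∨-zeroʳ _)
  ... | tri≈ _ a≡b _ with toℕ-injective a≡b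
  ... | refl = contradiction (trans (sym (proj₂ (crosses⁻ S a a e))) (xor-same (lookup S a))) λ ()

  cutEdges-closed : ∀ S → Closed (removeEdges G (cutEdges S)) S
  cutEdges-closed S {a} {b} e with ∧-not-true⁻ e | lookup S a xor lookup S b in parity
  ... | _      , _     | false = xor≡false⇒≡ parity
  ... | adj-ab , uncut | true  = contradiction (trans (sym uncut) (crosses⇒oriented S ab-crosses)) λ ()
    where
    ab-crosses : crosses S a b ≡ true
    ab-crosses = trans (cong (adj G a b ∧_) parity) (trans (∧-identityʳ _) adj-ab)

  cutSize≤edgeSubsetSize : ∀ T S → Closed (removeEdges G T) S → cutSize G S ≤ edgeSubsetSize G T
  cutSize≤edgeSubsetSize T S cS = pairCount-mono (crosses S) (proj₁ T) λ u v e →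
    let (u<v , uv-crosses) = oriented⁻ (crosses S) u v e
    in  oriented⁺ (proj₁ T) u<v (crossing∈T u<v uv-crosses)
    where
    crossing∈T : ∀ {u v} → toℕ u < toℕ v → crosses S u v ≡ true → proj₁ T u v ≡ true
    crossing∈T {u} {v} u<v uv-crosses with proj₁ T u v in Tuv | proj₁ T v u in Tvu
    ... | true  | _     = refl
    ... | false | true  = contradiction (proj₁ (proj₂ T v u Tvu)) (<⇒≯ u<v)
    ... | false | false =
      contradiction (trans (sym xor-uv) (trans (cong (_xor lookup S v) (cS uncut)) (xor-same (lookup S v)))) λ ()
      where
      adj-uv : adj G u v ≡ true
      adj-uv = proj₁ (crosses⁻ S u v uv-crosses)
      xor-uv : lookup S u xor lookup S v ≡ true
      xor-uv = proj₂ (crosses⁻ S u v uv-crosses)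
      uncut : removeEdges G T u v ≡ true
      uncut = trans (cong₂ (λ x y → adj G u v ∧ not (x ∨ y)) Tuv Tvu) (trans (∧-identityʳ _) adj-uv)

isBalanced? : ∀ p q → Decidable (IsBalanced {n} p q)
isBalanced? p q S = (_ ≤? _) ×-dec (_ ≤? _)

balanced⇔ : .{{NonZero n}} → k ≤ n → (S : Subset n) → IsBalanced (n ∸ k) n S ⇔ (n ∸ k ≤ ∣ S ∣ × ∣ S ∣ ≤ k)
balanced⇔ {n} {k} k≤n S = mk⇔
  (λ (lower , upper) → *-cancelˡ-≤ n (subst (_≤ n * ∣ S ∣) (*-comm (n ∸ k) n) lower) ,
                       *-cancelˡ-≤ n (subst (n * ∣ S ∣ ≤_) scale upper))
  (λ (lower , upper) → subst (_≤ n * ∣ S ∣) (*-comm n (n ∸ k)) (*-monoʳ-≤ n lower) ,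
                       subst (n * ∣ S ∣ ≤_) (sym scale) (*-monoʳ-≤ n upper))
  where
  scale : (n ∸ (n ∸ k)) * n ≡ n * k
  scale = trans (cong (_* n) (m∸[m∸n]≡n k≤n)) (*-comm k n)

excess-bounds : k < n → 2 * n ≤ 3 * k → 0 < n ∸ k × (n ∸ k) + (n ∸ k) ≤ k
excess-bounds {k} {n} k<n 2n≤3k =
  m<n⇒0<n∸m k<n , +-cancelʳ-≤ (k + k) (d + d) k (subst₂ _≤_ (twice k d) (thrice k) 2[k+d]≤3k)
  where
  d : ℕ
  d = n ∸ k
  2[k+d]≤3k : 2 * (k + d) ≤ 3 * k
  2[k+d]≤3k = subst (λ m → 2 * m ≤ 3 * k) (sym (m+[n∸m]≡n (<⇒≤ k<n))) 2n≤3k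
  twice : ∀ k d → 2 * (k + d) ≡ (d + d) + (k + k)
  twice = solve-∀
  thrice : ∀ k → 3 * k ≡ k + (k + k)
  thrice = solve-∀

balanced⇒separator : .{{NonZero n}} → (G : Graph n) → k ≤ n → ∀ S → IsBalanced (n ∸ k) n S →
                     IsKEdgeSeparator G k (cutEdges G S)
balanced⇒separator {n} {k} G k≤n S balanced =
  closed⇒componentsAtMost (removeEdges G (cutEdges G S)) S (cutEdges-closed G S) ∣S∣≤k ∣∁S∣≤k
  where
  bounds : n ∸ k ≤ ∣ S ∣ × ∣ S ∣ ≤ k
  bounds = Equivalence.to (balanced⇔ k≤n S) balanced
  ∣S∣≤k : ∣ S ∣ ≤ k
  ∣S∣≤k = proj₂ bounds
  ∣∁S∣≤k : ∣ ∁ S ∣ ≤ k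
  ∣∁S∣≤k = begin
    ∣ ∁ S ∣        ≡⟨ ∣∁p∣≡n∸∣p∣ S ⟩
    n ∸ ∣ S ∣      ≤⟨ ∸-monoʳ-≤ n (proj₁ bounds) ⟩
    n ∸ (n ∸ k)    ≡⟨ m∸[m∸n]≡n k≤n ⟩
    k              ∎
    where open ≤-Reasoning

-- Reachability is not shown decidable; excluded middle for it is available under ¬¬, and
-- ¬¬ is harmless because the final inequality between naturals is decidable.
separator⇒¬¬balancedCut≤ : (G : Graph n) → k < n → 2 * n ≤ 3 * k → ∀ T → IsKEdgeSeparator G k T →
                           ¬ ¬ (∃[ S ] IsBalanced (n ∸ k) n S × cutSize G S ≤ edgeSubsetSize G T)
separator⇒¬¬balancedCut≤ {n} {k} G k<n 2n≤3k T separator =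
  ¬¬-map balancedCut (¬¬-∀ λ u → ¬¬-∀ λ v → ¬¬-excluded-middle)
  where
  instance
    nonZero : NonZero n
    nonZero = >-nonZero (m<n⇒0<n k<n)
  R : Fin n → Fin n → Bool
  R = removeEdges G T
  balancedCut : (∀ u v → Dec (Reach R u v)) → ∃[ S ] IsBalanced (n ∸ k) n S × cutSize G S ≤ edgeSubsetSize G T
  balancedCut reach? with excess-bounds k<n 2n≤3k
  ... | 0<L , 2L≤k
    with Components.componentUnion-between R (removeEdges-sym G T) reach? separator (m∸n≤m n k) 2L≤k 0<L
  ... | S , closed , lower , upper =
    S , Equivalence.from (balanced⇔ (<⇒≤ k<n) S) (lower , upper) ,
    cutSize≤edgeSubsetSize G T S closed

balanced-exists : k < n → 2 * n ≤ 3 * k → ∃[ S ] IsBalanced (n ∸ k) n S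
balanced-exists {k} {n} k<n 2n≤3k with subsetOfSize k (<⇒≤ k<n)
... | S , ∣S∣≡k = S , Equivalence.from (balanced⇔ (<⇒≤ k<n) S) (L≤∣S∣ , ≤-reflexive ∣S∣≡k)
  where
  instance
    nonZero : NonZero n
    nonZero = >-nonZero (m<n⇒0<n k<n)
  L≤∣S∣ : n ∸ k ≤ ∣ S ∣
  L≤∣S∣ = ≤-trans (m+n≤o⇒m≤o (n ∸ k) (proj₂ (excess-bounds k<n 2n≤3k))) (≤-reflexive (sym ∣S∣≡k))

lemma8 : (k k' : ℕ) → k < k' → 2 * k' ≤ 3 * k → (G : Graph k') →
    ∃[ m ] (KEdgeSepOpt G k m × BalancedCutOpt G (k' ∸ k) k' m)
lemma8 k n k<n 2n≤3k G
  with subset-argmin (isBalanced? (n ∸ k) n) (cutSize G) (balanced-exists k<n 2n≤3k)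
... | S , balanced , minimal =
  cutSize G S ,
  ((cutEdges G S , separator , edgeSubsetSize-cutEdges G S) , optimal) ,
  ((S , balanced , refl) , minimal)
  where
  instance
    nonZero : NonZero n
    nonZero = >-nonZero (m<n⇒0<n k<n)
  separator : IsKEdgeSeparator G k (cutEdges G S)
  separator = balanced⇒separator G (<⇒≤ k<n) S balanced
  optimal : ∀ T → IsKEdgeSeparator G k T → cutSize G S ≤ edgeSubsetSize G T
  optimal T separatorT = decidable-stable (_ ≤? _)
    (¬¬-map (λ (S′ , balanced′ , ≤T) → ≤-trans (minimal S′ balanced′) ≤T)
            (separator⇒¬¬balancedCut≤ G k<n 2n≤3k T separatorT))
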